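{- Let $w\in\Sigma_k$ and let $i\ge0$ be an integer. Then $\left|\{\Gamma\in\mathcal{Q}_w:\chi(\Gamma)=i\}\right|\le|w|^{2i}$.
   Context: $\Sigma_k$: finite not necessarily reduced words $w=g_{i_1}^{\alpha_1}\cdots g_{i_m}^{\alpha_m}$ ($\alpha_b=\pm1$), $|w|=m$. Associate symbols $s_0,\dots,s_m$ and the trail $s_0\to\cdots\to s_m$ with $b$-th step labeled $g_{i_b}^{\alpha_b}$. A partition of $\{s_0,\dots,s_m\}$ is realizable if for all $h,l$ with $i_h=i_l$: if $\alpha_h=\alpha_l$ then $s_{h-1}\equiv s_{l-1}\iff s_h\equiv s_l$; if $\alpha_h=-\alpha_l$ then $s_{h-1}\equiv s_l\iff s_h\equiv s_{l-1}$. Its quotient graph has the blocks as vertices and, for each $b$, an edge of color $i_b$ from the block of $s_{b-1}$ to that of $s_b$ (reversed if $\alpha_b=-1$), coinciding edges identified. $\mathcal{Q}_w$ is the set of quotient graphs of realizable partitions with $s_0\equiv s_m$; $\chi(\Gamma)=e_\Gamma-v_\Gamma+1$ where $v_\Gamma,e_\Gamma$ are the numbers of vertices and edges. -}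

module Defs where

open import Data.Nat using (ℕ; zero; suc; _≤_)
open import Data.Bool using (Bool; true; false)
open import Data.Fin using (Fin; toℕ; inject₁) renaming (suc to fsuc; zero to fzero)
open import Data.Fin.Properties using () renaming (_≟_ to _≟ᶠ_)
open import Data.Product using (_×_; _,_; proj₁; proj₂)
open import Data.Product.Properties using (≡-dec)
open import Data.Vec using (Vec; lookup)
open import Data.List using (List; length; filter; deduplicate; allFin; map)
open import Relation.Nullary using (¬_)
open import Relation.Nullary.Decidable using (yes; no)
open import Relation.Binary.PropositionalEquality using (_≡_)
open import Function.Bundles using (_⇔_)

-- A word of length m in the free group F_k = ⟨g_0,…,g_{k-1}⟩ (not necessarily
-- reduced): the b-th letter is (i_b , α_b) with α_b = true meaning exponent +1
-- and α_b = false meaning exponent -1.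
Word : ℕ → ℕ → Set
Word k m = Vec (Fin k × Bool) m

-- Symbols s_0,…,s_m are Fin (suc m).  Step b (0-based, b : Fin m) goes
-- from s_b to s_{b+1}.
src tgt : ∀ {m} → Fin m → Fin (suc m)
src b = inject₁ b
tgt b = fsuc b

-- A partition of Fin n is encoded canonically by the map sending each element
-- to the least element of its block: p x ≤ x and p (p x) ≡ p x.
-- This is a bijection between such vectors and set partitions of Fin n.
IsPartition : ∀ {n} → Vec (Fin n) n → Set
IsPartition {n} p = (x : Fin n) →
  (toℕ (lookup p x) ≤ toℕ x) × (lookup p (lookup p x) ≡ lookup p x)

Same : ∀ {n} → Vec (Fin n) n → Fin n → Fin n → Set
Same p s t = lookup p s ≡ lookup p t

color : ∀ {k m} → Word k m → Fin m → Fin k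
color w b = proj₁ (lookup w b)

sign : ∀ {k m} → Word k m → Fin m → Bool
sign w b = proj₂ (lookup w b)

RealPair : ∀ {k m} → Word k m → Vec (Fin (suc m)) (suc m) → Fin m → Fin m → Bool → Bool → Set
RealPair w p h l true  true  = Same p (src h) (src l) ⇔ Same p (tgt h) (tgt l)
RealPair w p h l false false = Same p (src h) (src l) ⇔ Same p (tgt h) (tgt l)
RealPair w p h l true  false = Same p (src h) (tgt l) ⇔ Same p (tgt h) (src l)
RealPair w p h l false true  = Same p (src h) (tgt l) ⇔ Same p (tgt h) (src l)

Realizable : ∀ {k m} → Word k m → Vec (Fin (suc m)) (suc m) → Set
Realizable w p = (h l : Fin _) → color w h ≡ color w l →
  RealPair w p h l (sign w h) (sign w l)

-- Number of vertices of the quotient graph = number of blocks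
-- = number of canonical representatives.
numVertices : ∀ {n} → Vec (Fin n) n → ℕ
numVertices {n} p = length (filter (λ x → lookup p x ≟ᶠ x) (allFin n))

edgeOf : ∀ {k m} → Word k m → Vec (Fin (suc m)) (suc m) → Fin m → Fin k × Fin (suc m) × Fin (suc m)
edgeOf w p b with sign w b
... | true  = color w b , lookup p (src b) , lookup p (tgt b)
... | false = color w b , lookup p (tgt b) , lookup p (src b)

numEdges : ∀ {k m} → Word k m → Vec (Fin (suc m)) (suc m) → ℕ
numEdges {k} {m} w p =
  length (deduplicate (≡-dec _≟ᶠ_ (≡-dec _≟ᶠ_ _≟ᶠ_)) (map (edgeOf w p) (allFin m)))

-- χ(Γ) = e_Γ - v_Γ + 1 = i, written without subtraction.
HasChi : ∀ {k m} → Word k m → Vec (Fin (suc m)) (suc m) → ℕ → Set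
HasChi w p i = numEdges w p ℕ.+ 1 ≡ numVertices p ℕ.+ i
  where import Data.Nat as ℕ

InQ : ∀ {k m} → Word k m → Vec (Fin (suc m)) (suc m) → Set
InQ {m = m} w p = IsPartition p × Realizable w p × Same p fzero (Data.Fin.fromℕ m)

-- Fix a word w of length m and a realizable partition p, and walk along the
-- trail s_0 → ⋯ → s_m in the quotient graph.  Step b either repeats an edge
-- already traversed, or is "fresh" (it enters a block that has not been seen,
-- i.e. s_{b+1} is the least element of its block), or it is "closing" (a new
-- edge into an old block).  Fresh steps never repeat an edge, so
--   e = #fresh + #closing   and   v = 1 + #fresh,   hence   χ = #closing.
-- Recording, for every closing step b, the pair (b , block of s_{b+1}) gives a
-- list of χ pairs in Fin m × Fin m (the target block precedes s_{b+1}, so it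
-- fits in Fin m).  By realizability the colored edges of the quotient are
-- partial bijections, so the block of s_{b+1} is forced whenever an earlier
-- step of the same color leaves the current block; otherwise step b is fresh
-- or closing.  Hence, by induction along the trail, this list determines p,
-- and p ↦ list is an injection into a set of size m^(2χ).
module Submission where

open import Defs
open import Level using (Level)
open import Data.Nat using (ℕ; zero; suc; s≤s; _≤_; _+_; _*_; _^_)
open import Data.Nat.Properties
  using (+-suc; +-comm; +-cancelˡ-≡; suc-injective; ≤-refl; <⇒≤; ≤-<-trans; <-irrefl; *-identityʳ; ^-*-assoc)
open import Data.Bool using (Bool; true; false)
open import Data.Fin using (Fin; toℕ; _<_; combine; pinch) renaming (zero to fzero; suc to fsuc)
open import Data.Fin.Properties
  using (any?; _<?_; <-cmp; injective⇒≤; combine-injective; pinch-injective; ≤̄⇒inject₁<)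
  renaming (_≟_ to _≟ᶠ_)
open import Data.Fin.Induction using (<-wellFounded)
open import Data.Product using (∃; _×_; _,_; proj₁; proj₂; swap)
open import Data.Product.Properties using (≡-dec)
open import Data.Vec using (Vec; lookup)
open import Data.Vec.Relation.Binary.Pointwise.Extensional using (ext; Pointwise-≡⇒≡)
open import Data.List using (List; []; _∷_; length; filter; deduplicate; allFin; map)
open import Data.List.Properties using (length-map; map-tabulate)
open import Data.List.Relation.Unary.All as All using (All)
import Data.List.Relation.Unary.All.Properties as All
open import Data.List.Relation.Unary.Any using (here; there)
open import Data.List.Relation.Unary.AllPairs using (_∷_; [])
open import Data.List.Relation.Unary.Unique.Propositional using (Unique)
import Data.List.Relation.Unary.Unique.Propositional.Properties as Unique
open import Data.List.Relation.Unary.Unique.DecPropositional.Properties using (deduplicate-!)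
open import Data.List.Relation.Binary.BagAndSetEquality using (_∼[_]_; set; ∼bag⇒↭)
open import Data.List.Relation.Binary.Permutation.Propositional.Properties using (↭-length)
open import Data.List.Membership.Propositional using (_∈_)
open import Data.List.Membership.Propositional.Properties
  using (∈-lookup; ∈-map⁺; ∈-map⁻; ∈-filter⁺; ∈-filter⁻; ∈-allFin; ∈-deduplicate⁺; ∈-deduplicate⁻)
open import Data.List.Membership.Propositional.Properties.WithK using (unique∧set⇒bag)
open import Function using (id; _∘_)
open import Function.Bundles using (Equivalence; mk⇔)
open import Induction.WellFounded using (WfRec)
import Induction.WellFounded as WF
open import Relation.Nullary using (¬_; yes; no; ¬?; contradiction)
open import Relation.Nullary.Decidable using (_×-dec_)
open import Relation.Unary using (Pred; Decidable)
open import Relation.Binary.Definitions using (DecidableEquality; tri<; tri≈; tri>)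
open import Relation.Binary.PropositionalEquality

private
  variable
    a b : Level
    A : Set a
    B : Set b

lookup-injective : ∀ {xs : List A} → Unique xs →
  ∀ i j → Data.List.lookup xs i ≡ Data.List.lookup xs j → i ≡ j
lookup-injective (_ ∷ _)        fzero    fzero    _ = refl
lookup-injective (x∉xs ∷ _)     fzero    (fsuc j) e = contradiction e (All.lookup x∉xs (∈-lookup j))
lookup-injective (x∉xs ∷ _)     (fsuc i) fzero    e = contradiction (sym e) (All.lookup x∉xs (∈-lookup i))
lookup-injective (_ ∷ xs-uniq)  (fsuc i) (fsuc j) e = cong fsuc (lookup-injective xs-uniq i j e)

count-injection : ∀ {n} {xs : List A} → Unique xs →
  (code : ∀ {x} → x ∈ xs → Fin n) →
  (∀ {x y} (x∈ : x ∈ xs) (y∈ : y ∈ xs) → code x∈ ≡ code y∈ → x ≡ y) →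
  length xs ≤ n
count-injection xs-uniq code code-injective =
  injective⇒≤ λ {i} {j} e → lookup-injective xs-uniq i j (code-injective (∈-lookup i) (∈-lookup j) e)

map-unique : ∀ (f : A → B) {xs : List A} → Unique xs →
  (∀ {x y} → x ∈ xs → y ∈ xs → f x ≡ f y → x ≡ y) → Unique (map f xs)
map-unique f []               _     = []
map-unique f (x∉xs ∷ xs-uniq) f-inj =
  All.map⁺ (All.tabulate λ y∈ e → All.lookup x∉xs y∈ (f-inj (here refl) (there y∈) e))
  ∷ map-unique f xs-uniq (λ x∈ y∈ → f-inj (there x∈) (there y∈))

unique-set-equal⇒same-length : ∀ {xs ys : List A} → Unique xs → Unique ys →
  xs ∼[ set ] ys → length xs ≡ length ys
unique-set-equal⇒same-length xs-uniq ys-uniq same =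
  ↭-length (∼bag⇒↭ (unique∧set⇒bag xs-uniq ys-uniq same))

count-map : ∀ {p} {P : Pred B p} (P? : Decidable P) (f : A → B) (xs : List A) →
  length (filter P? (map f xs)) ≡ length (filter (P? ∘ f) xs)
count-map P? f []       = refl
count-map P? f (x ∷ xs) with P? (f x)
... | yes _ = cong suc (count-map P? f xs)
... | no  _ = count-map P? f xs

count-split : ∀ {p q} {P : Pred A p} {Q : Pred A q} (P? : Decidable P) (Q? : Decidable Q) →
  (∀ {x} → Q x → P x) → (xs : List A) →
  length (filter P? xs) ≡ length (filter Q? xs) + length (filter (λ x → P? x ×-dec ¬? (Q? x)) xs)
count-split P? Q? Q⇒P []       = refl
count-split P? Q? Q⇒P (x ∷ xs) with P? x | Q? x
... | yes _ | yes _  = cong suc (count-split P? Q? Q⇒P xs)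
... | yes _ | no  _  = trans (cong suc (count-split P? Q? Q⇒P xs)) (sym (+-suc _ _))
... | no ¬p | yes q  = contradiction (Q⇒P q) ¬p
... | no  _ | no  _  = count-split P? Q? Q⇒P xs

encode : ∀ {n} i (xs : List (Fin n)) → length xs ≡ i → Fin (n ^ i)
encode zero    []       _  = fzero
encode (suc i) (x ∷ xs) eq = combine x (encode i xs (suc-injective eq))

encode-injective : ∀ {n} i (xs ys : List (Fin n)) (ex : length xs ≡ i) (ey : length ys ≡ i) →
  encode i xs ex ≡ encode i ys ey → xs ≡ ys
encode-injective zero    []       []       _  _  _ = refl
encode-injective (suc i) (x ∷ xs) (y ∷ ys) ex ey e
  with combine-injective x (encode i xs _) y (encode i ys _) e
... | refl , rest = cong (x ∷_) (encode-injective i xs ys _ _ rest)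

square-power : ∀ m i → (m * m) ^ i ≡ m ^ (2 * i)
square-power m i = trans (cong (λ n → (m * n) ^ i) (sym (*-identityʳ m))) (^-*-assoc m 2 i)

-- Number of distinct values of a function on Fin m: each value is attained a
-- first time, at a position that repeats no earlier value.
module FirstOccurrences {B : Set b} (_≟_ : DecidableEquality B) {m : ℕ} (f : Fin m → B) where

  Repeats : Fin m → Set b
  Repeats x = ∃ λ c → c < x × f c ≡ f x

  repeats? : Decidable Repeats
  repeats? x = any? (λ c → (c <? x) ×-dec (f c ≟ f x))

  firsts : List (Fin m)
  firsts = filter (¬? ∘ repeats?) (allFin m)

  first-occurrence : ∀ x → ∃ λ c → c ∈ firsts × f c ≡ f x
  first-occurrence = WF.All.wfRec <-wellFounded _ _ earliest
    where
    earliest : ∀ x → WfRec _<_ (λ x → ∃ λ c → c ∈ firsts × f c ≡ f x) x →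
      ∃ λ c → c ∈ firsts × f c ≡ f x
    earliest x ih with repeats? x
    ... | no new = x , ∈-filter⁺ (¬? ∘ repeats?) (∈-allFin x) new , refl
    ... | yes (c , c<x , fc≡fx) with ih c<x
    ...   | d , d∈ , fd≡fc = d , d∈ , trans fd≡fc fc≡fx

  firsts-separated : ∀ {c d} → c ∈ firsts → d ∈ firsts → f c ≡ f d → c ≡ d
  firsts-separated {c} {d} c∈ d∈ e with <-cmp c d
  ... | tri< c<d _ _ = contradiction (c , c<d , e) (proj₂ (∈-filter⁻ (¬? ∘ repeats?) {xs = allFin m} d∈))
  ... | tri≈ _ c≡d _ = c≡d
  ... | tri> _ _ d<c = contradiction (d , d<c , sym e) (proj₂ (∈-filter⁻ (¬? ∘ repeats?) {xs = allFin m} c∈))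

  distinct-values : length (deduplicate _≟_ (map f (allFin m))) ≡ length firsts
  distinct-values = trans
    (unique-set-equal⇒same-length (deduplicate-! _≟_ _) firsts-values-unique (mk⇔ to from))
    (length-map f firsts)
    where
    firsts-values-unique : Unique (map f firsts)
    firsts-values-unique =
      map-unique f (Unique.filter⁺ (¬? ∘ repeats?) (Unique.allFin⁺ m)) firsts-separated
    to : ∀ {y} → y ∈ deduplicate _≟_ (map f (allFin m)) → y ∈ map f firsts
    to y∈ with ∈-map⁻ f (∈-deduplicate⁻ _≟_ (map f (allFin m)) y∈)
    ... | x , _ , refl with first-occurrence x
    ...   | c , c∈ , fc≡fx = subst (_∈ map f firsts) fc≡fx (∈-map⁺ f c∈)
    from : ∀ {y} → y ∈ map f firsts → y ∈ deduplicate _≟_ (map f (allFin m))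
    from y∈ with ∈-map⁻ f y∈
    ... | x , _ , refl = ∈-deduplicate⁺ _≟_ (∈-map⁺ f (∈-allFin x))

orient : Bool → A × A → A × A
orient true  = id
orient false = swap

-- The pair e read in the direction of a step of sign s, when e was
-- traversed by a step of sign t.
align : Bool → Bool → A × A → A × A
align true  true  = id
align false false = id
align true  false = swap
align false true  = swap

orient-align : ∀ s t (e e′ : A × A) → orient t e′ ≡ orient s e → e ≡ align s t e′
orient-align true  true  e e′ eq = sym eq
orient-align false false e e′ eq = sym (cong swap eq)
orient-align true  false e e′ eq = sym eq
orient-align false true  e e′ eq = sym (cong swap eq)

align-preserves : ∀ {p} (P : A → Set p) {e : A × A} → P (proj₁ e) → P (proj₂ e) →
  ∀ s t → P (proj₂ (align s t e))
align-preserves P P₁ P₂ true  true  = P₂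
align-preserves P P₁ P₂ false false = P₂
align-preserves P P₁ P₂ true  false = P₁
align-preserves P P₁ P₂ false true  = P₁

Partition : ℕ → Set
Partition m = Vec (Fin (suc m)) (suc m)

_≟E_ : ∀ {k m} → DecidableEquality (Fin k × Fin (suc m) × Fin (suc m))
_≟E_ = ≡-dec _≟ᶠ_ (≡-dec _≟ᶠ_ _≟ᶠ_)

ends : ∀ {m} → Partition m → Fin m → Fin (suc m) × Fin (suc m)
ends p b = lookup p (src b) , lookup p (tgt b)

module Steps {k m : ℕ} (w : Word k m) (p : Partition m) where

  edgeOf-oriented : ∀ b → edgeOf w p b ≡ (color w b , orient (sign w b) (ends p b))
  edgeOf-oriented b with sign w b
  ... | true  = refl
  ... | false = refl

  open FirstOccurrences _≟E_ (edgeOf w p) public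
    using () renaming (Repeats to Repeated; repeats? to repeated?; firsts to unrepeated)

  Fresh : Fin m → Set
  Fresh b = lookup p (tgt b) ≡ tgt b

  fresh? : Decidable Fresh
  fresh? b = lookup p (tgt b) ≟ᶠ tgt b

  Closing : Fin m → Set
  Closing b = ¬ Repeated b × ¬ Fresh b

  closing? : Decidable Closing
  closing? b = ¬? (repeated? b) ×-dec ¬? (fresh? b)

  -- Step b leaves its block along an edge of its color traversed earlier.
  Forced : Fin m → Set
  Forced b = ∃ λ c → c < b × color w c ≡ color w b ×
    lookup p (src b) ≡ proj₁ (align (sign w b) (sign w c) (ends p c))

  forced? : Decidable Forced
  forced? b = any? λ c → (c <? b) ×-dec (color w c ≟ᶠ color w b) ×-dec
    (lookup p (src b) ≟ᶠ proj₁ (align (sign w b) (sign w c) (ends p c)))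

  same-edge : ∀ {b c} → edgeOf w p c ≡ edgeOf w p b →
    color w c ≡ color w b × ends p b ≡ align (sign w b) (sign w c) (ends p c)
  same-edge {b} {c} e =
    let e′ = trans (sym (edgeOf-oriented c)) (trans e (edgeOf-oriented b))
    in cong proj₁ e′ , orient-align (sign w b) (sign w c) (ends p b) (ends p c) (cong proj₂ e′)

  repeated⇒forced : ∀ {b} → Repeated b → Forced b
  repeated⇒forced (c , c<b , e) with same-edge e
  ... | col , ends≡ = c , c<b , col , cong proj₁ ends≡

  realizable⇒deterministic : Realizable w p → ∀ {b c} → color w c ≡ color w b →
    lookup p (src b) ≡ proj₁ (align (sign w b) (sign w c) (ends p c)) →
    lookup p (tgt b) ≡ proj₂ (align (sign w b) (sign w c) (ends p c))
  realizable⇒deterministic real {b} {c} col = through (sign w b) (sign w c) (real b c (sym col))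
    where
    through : ∀ s t → RealPair w p b c s t →
      lookup p (src b) ≡ proj₁ (align s t (ends p c)) → lookup p (tgt b) ≡ proj₂ (align s t (ends p c))
    through true  true  r = Equivalence.to r
    through false false r = Equivalence.to r
    through true  false r = Equivalence.to r
    through false true  r = Equivalence.to r

  unforced⇒fresh : ∀ {b} → ¬ Forced b → ¬ Closing b → Fresh b
  unforced⇒fresh {b} unforced not-closing with fresh? b | repeated? b
  ... | yes fresh | _            = fresh
  ... | no  _     | yes repeated = contradiction (repeated⇒forced repeated) unforced
  ... | no stale  | no unrep     = contradiction (unrep , stale) not-closing

  -- The closing code of step b: its position and the block it enters; by
  -- pinching at b the block fits in Fin m without losing information, since
  -- for a non-fresh step the block differs from s_{b+1}.
  closingCode : Fin m → Fin (m * m)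
  closingCode b = combine b (pinch b (lookup p (tgt b)))

  codes : List (Fin (m * m))
  codes = map closingCode (filter closing? (allFin m))

  edge-count : numEdges w p ≡ length unrepeated
  edge-count = FirstOccurrences.distinct-values _≟E_ (edgeOf w p)

  module _ (part : IsPartition p) where

    block-root : lookup p fzero ≡ fzero
    block-root with lookup p fzero | proj₁ (part fzero)
    ... | fzero | _ = refl

    earlier-blocks : ∀ {b c} → c < b → proj₂ (align (sign w b) (sign w c) (ends p c)) < tgt b
    earlier-blocks {b} {c} c<b =
      align-preserves (_< tgt b) (below (≤̄⇒inject₁< (<⇒≤ c<b))) (below (s≤s c<b))
        (sign w b) (sign w c)
      where
      below : ∀ {x} → x < tgt b → lookup p x < tgt b
      below x< = ≤-<-trans (proj₁ (part _)) x<

    -- A fresh step reaches a block no earlier edge touches, so its edge is new.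
    fresh⇒unrepeated : ∀ {b} → Fresh b → ¬ Repeated b
    fresh⇒unrepeated {b} fresh (c , c<b , e) = <-irrefl (cong toℕ reached) (earlier-blocks c<b)
      where
      reached : proj₂ (align (sign w b) (sign w c) (ends p c)) ≡ tgt b
      reached = trans (sym (cong proj₂ (proj₂ (same-edge e)))) fresh

    -- The blocks are represented by s_0 and by the targets of the fresh steps.
    vertex-count : numVertices p ≡ suc (length (filter fresh? (allFin m)))
    vertex-count with lookup p fzero ≟ᶠ fzero
    ... | no not-root = contradiction block-root not-root
    ... | yes _ = cong suc (trans
      (cong (length ∘ filter (λ x → lookup p x ≟ᶠ x)) (sym (map-tabulate id fsuc)))
      (count-map (λ x → lookup p x ≟ᶠ x) fsuc (allFin m)))

    closing-count : ∀ {i} → HasChi w p i → length codes ≡ i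
    closing-count {i} chi = trans (length-map closingCode (filter closing? (allFin m)))
      (+-cancelˡ-≡ #fresh _ _ (suc-injective (begin
        suc (#fresh + #closing)   ≡⟨ +-comm 1 (#fresh + #closing) ⟩
        #fresh + #closing + 1     ≡⟨ cong (_+ 1) (sym unrepeated-split) ⟩
        length unrepeated + 1     ≡⟨ cong (_+ 1) (sym edge-count) ⟩
        numEdges w p + 1          ≡⟨ chi ⟩
        numVertices p + i         ≡⟨ cong (_+ i) vertex-count ⟩
        suc (#fresh + i)          ∎)))
      where
      open ≡-Reasoning
      #fresh #closing : ℕ
      #fresh   = length (filter fresh? (allFin m))
      #closing = length (filter closing? (allFin m))
      unrepeated-split : length unrepeated ≡ #fresh + #closing
      unrepeated-split = count-split (¬? ∘ repeated?) fresh? fresh⇒unrepeated (allFin m)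

open Steps using (Forced; Closing; codes)

Agree : ∀ {m} → Partition m → Partition m → Fin (suc m) → Set
Agree p q = WfRec _<_ (λ y → lookup p y ≡ lookup q y)

module _ {k m : ℕ} (w : Word k m) where

  closing-transfer : ∀ {p q : Partition m} → codes w p ≡ codes w q → ∀ {b} → Closing w p b →
    Closing w q b × lookup p (tgt b) ≡ lookup q (tgt b)
  closing-transfer {p} {q} same {b} closing
    with ∈-map⁻ (Steps.closingCode w q)
           (subst (_ ∈_) same (∈-map⁺ (Steps.closingCode w p)
             (∈-filter⁺ (Steps.closing? w p) (∈-allFin b) closing)))
  ... | c , c∈ , e with combine-injective b _ c _ e
  ...   | refl , pinched =
    closing-q , pinch-injective (proj₂ closing ∘ sym) (proj₂ closing-q ∘ sym) pinched
    where
    closing-q : Closing w q b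
    closing-q = proj₂ (∈-filter⁻ (Steps.closing? w q) {xs = allFin m} c∈)

  ends-agree : ∀ (p q : Partition m) {b c : Fin m} → Agree p q (tgt b) → c < b → ends p c ≡ ends q c
  ends-agree p q agree c<b = cong₂ _,_ (agree (≤̄⇒inject₁< (<⇒≤ c<b))) (agree (s≤s c<b))

  departure-transfer : ∀ (p q : Partition m) {b c : Fin m} → Agree p q (tgt b) → c < b →
    lookup p (src b) ≡ proj₁ (align (sign w b) (sign w c) (ends p c)) →
    lookup q (src b) ≡ proj₁ (align (sign w b) (sign w c) (ends q c))
  departure-transfer p q {b} {c} agree c<b dep = begin
    lookup q (src b)          ≡⟨ sym (agree (≤̄⇒inject₁< (≤-refl {toℕ b}))) ⟩
    lookup p (src b)          ≡⟨ dep ⟩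
    proj₁ (along (ends p c))  ≡⟨ cong (proj₁ ∘ along) (ends-agree p q agree c<b) ⟩
    proj₁ (along (ends q c))  ∎
    where
    open ≡-Reasoning
    along : Fin (suc m) × Fin (suc m) → Fin (suc m) × Fin (suc m)
    along = align (sign w b) (sign w c)

  forced-transfer : ∀ (p q : Partition m) {b : Fin m} → Agree p q (tgt b) → Forced w p b → Forced w q b
  forced-transfer p q agree (c , c<b , col , dep) = c , c<b , col , departure-transfer p q agree c<b dep

  module _ {p q : Partition m} (real-p : Realizable w p) (real-q : Realizable w q)
           (same : codes w p ≡ codes w q) where

    agree-step : ∀ b → Agree p q (tgt b) → lookup p (tgt b) ≡ lookup q (tgt b)
    agree-step b agree with Steps.forced? w p b
    ... | yes (c , c<b , col , dep) = begin
      lookup p (tgt b)          ≡⟨ Steps.realizable⇒deterministic w p real-p col dep ⟩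
      proj₂ (along (ends p c))  ≡⟨ cong (proj₂ ∘ along) (ends-agree p q agree c<b) ⟩
      proj₂ (along (ends q c))  ≡⟨ sym (Steps.realizable⇒deterministic w q real-q col dep-q) ⟩
      lookup q (tgt b)          ∎
      where
      open ≡-Reasoning
      along : Fin (suc m) × Fin (suc m) → Fin (suc m) × Fin (suc m)
      along = align (sign w b) (sign w c)
      dep-q : lookup q (src b) ≡ proj₁ (along (ends q c))
      dep-q = departure-transfer p q agree c<b dep
    agree-step b agree | no unforced with Steps.closing? w p b | Steps.closing? w q b
    ... | yes closing | _           = proj₂ (closing-transfer same closing)
    ... | no _        | yes closing = sym (proj₂ (closing-transfer (sym same) closing))
    ... | no open-p   | no open-q   = trans
      (Steps.unforced⇒fresh w p unforced open-p)
      (sym (Steps.unforced⇒fresh w q (unforced ∘ forced-transfer q p (sym ∘ agree)) open-q))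

    codes-determine : IsPartition p → IsPartition q → p ≡ q
    codes-determine part-p part-q =
      Pointwise-≡⇒≡ (ext (WF.All.wfRec <-wellFounded _ _ agree-at))
      where
      agree-at : ∀ z → Agree p q z → lookup p z ≡ lookup q z
      agree-at fzero    _     = trans (Steps.block-root w p part-p) (sym (Steps.block-root w q part-q))
      agree-at (fsuc b) agree = agree-step b agree

lemma9 : (k m : ℕ) (w : Word k m) (i : ℕ)
    (L : List (Vec (Fin (suc m)) (suc m))) →
    Unique L → All (λ p → InQ w p × HasChi w p i) L →
    length L ≤ m ^ (2 * i)
lemma9 k m w i L L-unique members =
  subst (length L ≤_) (square-power m i) (count-injection L-unique code code-injective)
  where
  code-length : ∀ {p} (p∈ : p ∈ L) → length (codes w p) ≡ i
  code-length p∈ with All.lookup members p∈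
  ... | (part , _) , chi = Steps.closing-count w _ part chi

  code : ∀ {p} → p ∈ L → Fin ((m * m) ^ i)
  code p∈ = encode i (codes w _) (code-length p∈)

  code-injective : ∀ {p q} (p∈ : p ∈ L) (q∈ : q ∈ L) → code p∈ ≡ code q∈ → p ≡ q
  code-injective p∈ q∈ e with All.lookup members p∈ | All.lookup members q∈
  ... | (part-p , real-p , _) , _ | (part-q , real-q , _) , _ =
    codes-determine w real-p real-q (encode-injective i _ _ _ _ e) part-p part-q
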